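{- Let $n\geq 2$ and let $M=(a_{i,j})_{1\leq i,j\leq n}$ be a Steinhaus matrix of size $n$ with associated Steinhaus graph $G$ on vertices $V_1,\ldots,V_n$. Then for all $1\leq i\leq\left\lfloor \frac{n}{2}\right\rfloor$, $$ a_{i,n-i+1} \equiv \sum_{k=0}^{i-1}{\binom{i-1}{k}\deg\left(V_{i+k+1}\right)} \equiv \sum_{k=0}^{i-1}{\binom{i-1}{k}\deg\left(V_{n-i-k}\right)} \pmod{2}, $$ where the entry $a_{i,n-i+1}\in\{0,1\}$ is viewed as an integer.
   Context: A Steinhaus matrix of size $n\geq1$ is a matrix $M=(a_{i,j})_{1\leq i,j\leq n}$ with entries in $\mathbb{F}_2=\{0,1\}$ such that $a_{i,i}=0$ for all $i$, $a_{i,j}=a_{i-1,j-1}+a_{i-1,j}$ (addition in $\mathbb{F}_2$) for all $2\leq i<j\leq n$, and $a_{i,j}=a_{j,i}$ for all $i,j$. The Steinhaus graph associated with $M$ is the simple graph on vertices $V_1,\ldots,V_n$ whose adjacency matrix is $M$ ($V_i$ and $V_j$ are adjacent iff $a_{i,j}=1$). $\deg(V_i)$ denotes the degree of $V_i$, i.e. $\sum_{j=1}^n a_{i,j}$ with entries viewed as integers $0,1$. -}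

module Defs where

open import Data.Nat using (ℕ; zero; suc; _+_; _*_; _∸_; _≤_; _<_)
open import Data.Nat.Combinatorics using (_C_)
open import Data.Bool using (Bool; true; false; _xor_)
open import Data.List using (map; upTo)
open import Data.Nat.ListAction using (sum)
open import Relation.Binary.PropositionalEquality using (_≡_)

-- Matrices are represented 1-based as functions ℕ → ℕ → Bool (Bool = F₂,
-- false = 0, true = 1, _xor_ = addition in F₂); only the entries with
-- indices 1 ≤ i, j ≤ n are meaningful / constrained.
Matrix : Set
Matrix = ℕ → ℕ → Bool

record IsSteinhaus (n : ℕ) (a : Matrix) : Set where
  field
    diag : ∀ i → 1 ≤ i → i ≤ n → a i i ≡ false
    step : ∀ i j → 2 ≤ i → i < j → j ≤ n →
           a i j ≡ (a (i ∸ 1) (j ∸ 1) xor a (i ∸ 1) j)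
    symm : ∀ i j → 1 ≤ i → i ≤ n → 1 ≤ j → j ≤ n → a i j ≡ a j i

b2n : Bool → ℕ
b2n true  = 1
b2n false = 0

Σ< : ℕ → (ℕ → ℕ) → ℕ
Σ< m f = sum (map f (upTo m))

deg : ℕ → Matrix → ℕ → ℕ
deg n a i = Σ< n (λ j → b2n (a i (suc j)))

-- Over F₂ the binomial sum Σₖ C(m,k) f(k) is the m-th iterated difference of f, and
-- the upper triangle of a Steinhaus matrix is the Pascal triangle mod 2 generated by
-- its first row.  Along a row, a diagonal or a column of that triangle the m-th
-- difference of consecutive entries is again an entry of the triangle.  Telescoping
-- along row and column j writes deg(V_j) mod 2 as a sum of four entries lying on such
-- lines; for i = m+1, taking the m-th difference over j = i+1, …, 2i, three of the four
-- resulting entries cancel by the Pascal rule and a_{i,n-i+1} remains.  The second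
-- congruence is the first one for the matrix reflected in its antidiagonal, which is
-- again a Steinhaus matrix.
module Submission where

open import Defs
open import Data.Nat using (ℕ; zero; suc; _+_; _*_; _∸_; _≤_; _<_; _/_; _%_; z≤n; s≤s; s≤s⁻¹; parity)
open import Data.Nat.Properties
open import Data.Nat.DivMod using (m/n*n≤m)
open import Data.Nat.Combinatorics using (_C_; nCk+nC[k+1]≡[n+1]C[k+1]; k>n⇒nCk≡0)
open import Data.Nat.ListAction using (sum)
open import Data.Bool using (Bool; true; false; _xor_)
open import Data.Bool.Properties using (xor-assoc; xor-same; xor-identityʳ)
open import Data.List.Properties using (map-applyUpTo; map-upTo)
open import Data.Parity.Base using (Parity; 0ℙ) renaming (_+_ to _⊕_)
import Data.Parity.Properties as ℙ
open import Data.Product using (_×_; _,_)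
import Algebra.Properties.CommutativeSemigroup as CommutativeSemigroupProperties
open import Relation.Binary.PropositionalEquality
  using (_≡_; refl; sym; trans; cong; cong₂; module ≡-Reasoning)

open ≡-Reasoning

p⊕[p⊕q]≡q : ∀ p q → p ⊕ (p ⊕ q) ≡ q
p⊕[p⊕q]≡q p q = trans (sym (ℙ.+-assoc p p q)) (cong (_⊕ q) (ℙ.p+p≡0ℙ p))

p⊕[q⊕p]≡q : ∀ p q → p ⊕ (q ⊕ p) ≡ q
p⊕[q⊕p]≡q p q = trans (cong (p ⊕_) (ℙ.+-comm q p)) (p⊕[p⊕q]≡q p q)

fromBool : Bool → Parity
fromBool b = parity (b2n b)

fromBool-xor : ∀ x y → fromBool (x xor y) ≡ fromBool x ⊕ fromBool y
fromBool-xor false y     = refl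
fromBool-xor true  false = refl
fromBool-xor true  true  = refl

xor-cancelʳ : ∀ x y → (x xor y) xor y ≡ x
xor-cancelʳ x y = begin
  (x xor y) xor y ≡⟨ xor-assoc x y y ⟩
  x xor (y xor y) ≡⟨ cong (x xor_) (xor-same y) ⟩
  x xor false     ≡⟨ xor-identityʳ x ⟩
  x               ∎

parity≡⇒%2≡ : ∀ m n → parity m ≡ parity n → m % 2 ≡ n % 2
parity≡⇒%2≡ zero          zero          _ = refl
parity≡⇒%2≡ zero          (suc zero)    ()
parity≡⇒%2≡ (suc zero)    zero          ()
parity≡⇒%2≡ (suc zero)    (suc zero)    _ = refl
parity≡⇒%2≡ (suc (suc m)) n             e = parity≡⇒%2≡ m n e
parity≡⇒%2≡ zero          (suc (suc n)) e = parity≡⇒%2≡ zero n e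
parity≡⇒%2≡ (suc zero)    (suc (suc n)) e = parity≡⇒%2≡ (suc zero) n e

i≤n/2⇒i+i≤n : ∀ i n → i ≤ n / 2 → i + i ≤ n
i≤n/2⇒i+i≤n i n i≤n/2 = ≤-trans (≤-reflexive i+i≡i*2) (≤-trans (*-monoˡ-≤ 2 i≤n/2) (m/n*n≤m n 2))
  where
  i+i≡i*2 : i + i ≡ i * 2
  i+i≡i*2 = trans (cong (i +_) (sym (+-identityʳ i))) (*-comm 2 i)

Σ<-suc : ∀ m f → Σ< (suc m) f ≡ f 0 + Σ< m (λ k → f (suc k))
Σ<-suc m f = cong (f 0 +_) (cong sum (trans (map-applyUpTo suc f m) (sym (map-upTo _ m))))

Σ<-cong : ∀ m {f g} → (∀ k → k < m → f k ≡ g k) → Σ< m f ≡ Σ< m g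
Σ<-cong zero    eq = refl
Σ<-cong (suc m) {f} {g} eq = begin
  Σ< (suc m) f                  ≡⟨ Σ<-suc m f ⟩
  f 0 + Σ< m (λ k → f (suc k))  ≡⟨ cong₂ _+_ (eq 0 (s≤s z≤n)) (Σ<-cong m (λ k k<m → eq (suc k) (s≤s k<m))) ⟩
  g 0 + Σ< m (λ k → g (suc k))  ≡⟨ Σ<-suc m g ⟨
  Σ< (suc m) g                  ∎

Σ<-snoc : ∀ m f → Σ< (suc m) f ≡ Σ< m f + f m
Σ<-snoc zero    f = +-identityʳ (f 0)
Σ<-snoc (suc m) f = begin
  Σ< (2 + m) f                              ≡⟨ Σ<-suc (suc m) f ⟩
  f 0 + Σ< (suc m) (λ k → f (suc k))        ≡⟨ cong (f 0 +_) (Σ<-snoc m _) ⟩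
  f 0 + (Σ< m (λ k → f (suc k)) + f (suc m)) ≡⟨ +-assoc (f 0) _ _ ⟨
  f 0 + Σ< m (λ k → f (suc k)) + f (suc m)  ≡⟨ cong (_+ f (suc m)) (Σ<-suc m f) ⟨
  Σ< (suc m) f + f (suc m)                  ∎

Σ<-+ : ∀ m f g → Σ< m (λ k → f k + g k) ≡ Σ< m f + Σ< m g
Σ<-+ zero    f g = refl
Σ<-+ (suc m) f g = begin
  Σ< (suc m) (λ k → f k + g k)                        ≡⟨ Σ<-suc m _ ⟩
  (f 0 + g 0) + Σ< m (λ k → f (suc k) + g (suc k))    ≡⟨ cong ((f 0 + g 0) +_) (Σ<-+ m _ _) ⟩
  (f 0 + g 0) + (Σ< m f′ + Σ< m g′)                   ≡⟨ interchange (f 0) (g 0) _ _ ⟩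
  (f 0 + Σ< m f′) + (g 0 + Σ< m g′)                   ≡⟨ cong₂ _+_ (Σ<-suc m f) (Σ<-suc m g) ⟨
  Σ< (suc m) f + Σ< (suc m) g                         ∎
  where
  open CommutativeSemigroupProperties +-commutativeSemigroup using (interchange)
  f′ g′ : ℕ → ℕ
  f′ k = f (suc k)
  g′ k = g (suc k)

Σ<-reverse : ∀ m f → Σ< m f ≡ Σ< m (λ l → f (m ∸ suc l))
Σ<-reverse zero    f = refl
Σ<-reverse (suc m) f = begin
  Σ< (suc m) f                              ≡⟨ Σ<-snoc m f ⟩
  Σ< m f + f m                              ≡⟨ cong (_+ f m) (Σ<-reverse m f) ⟩
  Σ< m (λ l → f (m ∸ suc l)) + f m          ≡⟨ +-comm _ (f m) ⟩
  f m + Σ< m (λ l → f (m ∸ suc l))          ≡⟨ Σ<-suc m _ ⟨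
  Σ< (suc m) (λ l → f (suc m ∸ suc l))      ∎

Σℙ< : ℕ → (ℕ → Parity) → Parity
Σℙ< zero    f = 0ℙ
Σℙ< (suc m) f = f 0 ⊕ Σℙ< m (λ k → f (suc k))

parity-Σ< : ∀ m f → parity (Σ< m f) ≡ Σℙ< m (λ k → parity (f k))
parity-Σ< zero    f = refl
parity-Σ< (suc m) f = begin
  parity (Σ< (suc m) f)                               ≡⟨ cong parity (Σ<-suc m f) ⟩
  parity (f 0 + Σ< m (λ k → f (suc k)))               ≡⟨ ℙ.+-homo-+ (f 0) _ ⟩
  parity (f 0) ⊕ parity (Σ< m (λ k → f (suc k)))      ≡⟨ cong (parity (f 0) ⊕_) (parity-Σ< m _) ⟩
  parity (f 0) ⊕ Σℙ< m (λ k → parity (f (suc k)))     ∎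

Σℙ<-cong : ∀ m {f g} → (∀ k → k < m → f k ≡ g k) → Σℙ< m f ≡ Σℙ< m g
Σℙ<-cong zero    eq = refl
Σℙ<-cong (suc m) eq = cong₂ _⊕_ (eq 0 (s≤s z≤n)) (Σℙ<-cong m (λ k k<m → eq (suc k) (s≤s k<m)))

Σℙ<-split : ∀ k r f → Σℙ< (k + r) f ≡ Σℙ< k f ⊕ Σℙ< r (λ t → f (k + t))
Σℙ<-split zero    r f = refl
Σℙ<-split (suc k) r f = trans (cong (f 0 ⊕_) (Σℙ<-split k r _)) (sym (ℙ.+-assoc (f 0) _ _))

Σℙ<-telescope : ∀ k h → Σℙ< k (λ l → h l ⊕ h (suc l)) ≡ h 0 ⊕ h k
Σℙ<-telescope zero    h = sym (ℙ.p+p≡0ℙ (h 0))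
Σℙ<-telescope (suc k) h = begin
  (h 0 ⊕ h 1) ⊕ Σℙ< k (λ l → h (suc l) ⊕ h (2 + l))
    ≡⟨ cong ((h 0 ⊕ h 1) ⊕_) (Σℙ<-telescope k (λ l → h (suc l))) ⟩
  (h 0 ⊕ h 1) ⊕ (h 1 ⊕ h (suc k))
    ≡⟨ ℙ.+-assoc (h 0) (h 1) _ ⟩
  h 0 ⊕ (h 1 ⊕ (h 1 ⊕ h (suc k)))
    ≡⟨ cong (h 0 ⊕_) (p⊕[p⊕q]≡q (h 1) _) ⟩
  h 0 ⊕ h (suc k)
    ∎

-- Binomial sums mod 2 as iterated differences

Δ : ℕ → (ℕ → Parity) → Parity
Δ zero    f = f 0
Δ (suc m) f = Δ m f ⊕ Δ m (λ k → f (suc k))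

Δ-cong : ∀ m {f g} → (∀ k → k ≤ m → f k ≡ g k) → Δ m f ≡ Δ m g
Δ-cong zero    eq = eq 0 z≤n
Δ-cong (suc m) eq = cong₂ _⊕_ (Δ-cong m (λ k k≤m → eq k (m≤n⇒m≤1+n k≤m)))
                              (Δ-cong m (λ k k≤m → eq (suc k) (s≤s k≤m)))

Δ-⊕ : ∀ m f g → Δ m (λ k → f k ⊕ g k) ≡ Δ m f ⊕ Δ m g
Δ-⊕ zero    f g = refl
Δ-⊕ (suc m) f g = trans (cong₂ _⊕_ (Δ-⊕ m f g) (Δ-⊕ m _ _)) (interchange (Δ m f) (Δ m g) _ _)
  where open CommutativeSemigroupProperties ℙ.+-commutativeSemigroup using (interchange)

Σ<-binomial-step : ∀ m (g : ℕ → ℕ) →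
  Σ< (2 + m) (λ k → (suc m C k) * g k)
    ≡ Σ< (suc m) (λ k → (m C k) * g k) + Σ< (suc m) (λ k → (m C k) * g (suc k))
Σ<-binomial-step m g = begin
  Σ< (2 + m) (λ k → (suc m C k) * g k)
    ≡⟨ Σ<-suc (suc m) (λ k → (suc m C k) * g k) ⟩
  g₀ + Σ< (suc m) (λ k → (suc m C suc k) * g (suc k))
    ≡⟨ cong (g₀ +_) (Σ<-cong (suc m) {λ k → (suc m C suc k) * g (suc k)} (λ k _ → pascal-rule k)) ⟩
  g₀ + Σ< (suc m) (λ k → shifted k + next k)
    ≡⟨ cong (g₀ +_) (Σ<-+ (suc m) shifted next) ⟩
  g₀ + (Σ< (suc m) shifted + Σ< (suc m) next)
    ≡⟨ cong (λ x → g₀ + (Σ< (suc m) shifted + x)) last-term-vanishes ⟩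
  g₀ + (Σ< (suc m) shifted + Σ< m next)
    ≡⟨ cong (g₀ +_) (+-comm (Σ< (suc m) shifted) _) ⟩
  g₀ + (Σ< m next + Σ< (suc m) shifted)
    ≡⟨ +-assoc g₀ _ _ ⟨
  g₀ + Σ< m next + Σ< (suc m) shifted
    ≡⟨ cong (_+ Σ< (suc m) shifted) (Σ<-suc m (λ k → (m C k) * g k)) ⟨
  Σ< (suc m) (λ k → (m C k) * g k) + Σ< (suc m) shifted
    ∎
  where
  g₀ = 1 * g 0
  shifted next : ℕ → ℕ
  shifted k = (m C k) * g (suc k)
  next    k = (m C suc k) * g (suc k)
  pascal-rule : ∀ k → (suc m C suc k) * g (suc k) ≡ shifted k + next k
  pascal-rule k = trans (cong (_* g (suc k)) (sym (nCk+nC[k+1]≡[n+1]C[k+1] m k)))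
                        (*-distribʳ-+ (g (suc k)) (m C k) (m C suc k))
  last-term-vanishes : Σ< (suc m) next ≡ Σ< m next
  last-term-vanishes = begin
    Σ< (suc m) next                     ≡⟨ Σ<-snoc m next ⟩
    Σ< m next + (m C suc m) * g (suc m) ≡⟨ cong (λ c → Σ< m next + c * g (suc m)) (k>n⇒nCk≡0 (n<1+n m)) ⟩
    Σ< m next + 0                       ≡⟨ +-identityʳ _ ⟩
    Σ< m next                           ∎

parity-Σ<-binomial : ∀ m (g : ℕ → ℕ) →
  parity (Σ< (suc m) (λ k → (m C k) * g k)) ≡ Δ m (λ k → parity (g k))
parity-Σ<-binomial zero    g = cong parity (trans (+-identityʳ _) (+-identityʳ (g 0)))
parity-Σ<-binomial (suc m) g = begin
  parity (Σ< (2 + m) (λ k → (suc m C k) * g k))  ≡⟨ cong parity (Σ<-binomial-step m g) ⟩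
  parity (S g + S g′)                            ≡⟨ ℙ.+-homo-+ (S g) (S g′) ⟩
  parity (S g) ⊕ parity (S g′)                   ≡⟨ cong₂ _⊕_ (parity-Σ<-binomial m g) (parity-Σ<-binomial m g′) ⟩
  Δ (suc m) (λ k → parity (g k))                 ∎
  where
  S : (ℕ → ℕ) → ℕ
  S h = Σ< (suc m) (λ k → (m C k) * h k)
  g′ : ℕ → ℕ
  g′ k = g (suc k)

-- The Pascal triangle mod 2 generated by a first row

-- Row i is row i+1 of the matrix, columns are numbered as in the matrix; column 0 is junk.
pascal : (ℕ → Parity) → ℕ → ℕ → Parity
pascal r zero    j       = r j
pascal r (suc i) zero    = 0ℙ
pascal r (suc i) (suc j) = pascal r i j ⊕ pascal r i (suc j)

module _ (r : ℕ → Parity) where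

  private
    P : ℕ → ℕ → Parity
    P = pascal r

  Δ-pascal-row : ∀ m i c → Δ m (λ k → P i (c + k)) ≡ P (i + m) (c + m)
  Δ-pascal-row zero    i c = cong (λ x → P x (c + 0)) (sym (+-identityʳ i))
  Δ-pascal-row (suc m) i c = begin
    Δ m (λ k → P i (c + k)) ⊕ Δ m (λ k → P i (c + suc k))
      ≡⟨ cong (Δ m (λ k → P i (c + k)) ⊕_) (Δ-cong m (λ k _ → cong (P i) (+-suc c k))) ⟩
    Δ m (λ k → P i (c + k)) ⊕ Δ m (λ k → P i (suc c + k))
      ≡⟨ cong₂ _⊕_ (Δ-pascal-row m i c) (Δ-pascal-row m i (suc c)) ⟩
    P (suc (i + m)) (suc (c + m))
      ≡⟨ cong₂ P (sym (+-suc i m)) (sym (+-suc c m)) ⟩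
    P (i + suc m) (c + suc m)
      ∎

  Δ-pascal-diagonal : ∀ m i c → Δ m (λ k → P (i + k) (c + k)) ≡ P i (c + m)
  Δ-pascal-diagonal zero    i c = cong (λ x → P x (c + 0)) (+-identityʳ i)
  Δ-pascal-diagonal (suc m) i c = begin
    Δ m (λ k → P (i + k) (c + k)) ⊕ Δ m (λ k → P (i + suc k) (c + suc k))
      ≡⟨ cong (Δ m (λ k → P (i + k) (c + k)) ⊕_) (Δ-cong m (λ k _ → cong₂ P (+-suc i k) (+-suc c k))) ⟩
    Δ m (λ k → P (i + k) (c + k)) ⊕ Δ m (λ k → P (suc i + k) (suc c + k))
      ≡⟨ cong₂ _⊕_ (Δ-pascal-diagonal m i c) (Δ-pascal-diagonal m (suc i) (suc c)) ⟩
    P i (c + m) ⊕ (P i (c + m) ⊕ P i (suc (c + m)))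
      ≡⟨ p⊕[p⊕q]≡q (P i (c + m)) _ ⟩
    P i (suc (c + m))
      ≡⟨ cong (P i) (+-suc c m) ⟨
    P i (c + suc m)
      ∎

  Δ-pascal-column : ∀ m i c → Δ m (λ k → P (i + k) (c + m)) ≡ P i c
  Δ-pascal-column zero    i c = cong₂ P (+-identityʳ i) (+-identityʳ c)
  Δ-pascal-column (suc m) i c = begin
    Δ m (λ k → P (i + k) (c + suc m)) ⊕ Δ m (λ k → P (i + suc k) (c + suc m))
      ≡⟨ cong₂ _⊕_ (Δ-cong m (λ k _ → cong (P (i + k)) (+-suc c m)))
                   (Δ-cong m (λ k _ → cong₂ P (+-suc i k) (+-suc c m))) ⟩
    Δ m (λ k → P (i + k) (suc c + m)) ⊕ Δ m (λ k → P (suc i + k) (suc c + m))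
      ≡⟨ cong₂ _⊕_ (Δ-pascal-column m i (suc c)) (Δ-pascal-column m (suc i) (suc c)) ⟩
    P i (suc c) ⊕ (P i c ⊕ P i (suc c))
      ≡⟨ p⊕[q⊕p]≡q (P i (suc c)) (P i c) ⟩
    P i c
      ∎

  Σℙ<-pascal-row : ∀ k i c → Σℙ< k (λ l → P (suc i) (suc (l + c))) ≡ P i c ⊕ P i (k + c)
  Σℙ<-pascal-row k i c = Σℙ<-telescope k (λ l → P i (l + c))

  Σℙ<-pascal-column : ∀ k c → Σℙ< k (λ l → P l c) ≡ P 0 (suc c) ⊕ P k (suc c)
  Σℙ<-pascal-column k c = begin
    Σℙ< k (λ l → P l c)
      ≡⟨ Σℙ<-cong k (λ l _ → sym (p⊕[q⊕p]≡q (P l (suc c)) (P l c))) ⟩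
    Σℙ< k (λ l → P l (suc c) ⊕ P (suc l) (suc c))
      ≡⟨ Σℙ<-telescope k (λ l → P l (suc c)) ⟩
    P 0 (suc c) ⊕ P k (suc c)
      ∎

antitranspose : ℕ → Matrix → Matrix
antitranspose n a i j = a (suc n ∸ j) (suc n ∸ i)

1≤1+n∸i : ∀ {n i} → i ≤ n → 1 ≤ suc n ∸ i
1≤1+n∸i i≤n = m<n⇒0<n∸m (s≤s i≤n)

1+n∸i≤n : ∀ {n i} → 1 ≤ i → suc n ∸ i ≤ n
1+n∸i≤n {n} {suc i} _ = m∸n≤m n i

module _ {n : ℕ} {a : Matrix} (steinhaus : IsSteinhaus n a) where

  open IsSteinhaus steinhaus

  private
    firstRow : ℕ → Parity
    firstRow j = fromBool (a 1 j)
    P : ℕ → ℕ → Parity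
    P = pascal firstRow

  step-suc : ∀ i j → 1 ≤ i → i < j → suc j ≤ n → a (suc i) (suc j) ≡ a i j xor a i (suc j)
  step-suc i j 1≤i i<j j<n = step (suc i) (suc j) (s≤s 1≤i) (s≤s i<j) j<n

  steinhaus-pascal : ∀ i j → suc i < j → j ≤ n → fromBool (a (suc i) j) ≡ P i j
  steinhaus-pascal zero    j       _         _   = refl
  steinhaus-pascal (suc i) (suc j) (s≤s i<j) j<n = begin
    fromBool (a (2 + i) (suc j))
      ≡⟨ cong fromBool (step-suc (suc i) j (s≤s z≤n) i<j j<n) ⟩
    fromBool (a (suc i) j xor a (suc i) (suc j))
      ≡⟨ fromBool-xor (a (suc i) j) (a (suc i) (suc j)) ⟩
    fromBool (a (suc i) j) ⊕ fromBool (a (suc i) (suc j))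
      ≡⟨ cong₂ _⊕_ (steinhaus-pascal i j i<j (<⇒≤ j<n)) (steinhaus-pascal i (suc j) (m<n⇒m<1+n i<j) j<n) ⟩
    P (suc i) (suc j)
      ∎

  -- The first two terms come from column 2+v above the diagonal, the last two from row 2+v.
  parity-deg : ∀ v → 2 + v ≤ n →
    parity (deg n a (2 + v)) ≡ (P 0 (3 + v) ⊕ P (1 + v) (3 + v)) ⊕ (P v (2 + v) ⊕ P v n)
  parity-deg v j≤n = begin
    parity (deg n a (2 + v))
      ≡⟨ parity-Σ< n _ ⟩
    Σℙ< n f
      ≡⟨ cong (λ N → Σℙ< N f) n≡ ⟩
    Σℙ< (suc v + suc r) f
      ≡⟨ Σℙ<-split (suc v) (suc r) f ⟩
    Σℙ< (suc v) f ⊕ (f (suc v + 0) ⊕ Σℙ< r (λ t → f (suc v + suc t)))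
      ≡⟨ cong₂ _⊕_ above-diagonal (cong₂ _⊕_ on-diagonal right-of-diagonal) ⟩
    (P 0 (3 + v) ⊕ P (1 + v) (3 + v)) ⊕ (P v (2 + v) ⊕ P v n)
      ∎
    where
    f : ℕ → Parity
    f l = fromBool (a (2 + v) (suc l))
    r = n ∸ (2 + v)
    n≡ : n ≡ suc v + suc r
    n≡ = sym (trans (cong suc (+-suc v r)) (m+[n∸m]≡n j≤n))
    above-diagonal : Σℙ< (suc v) f ≡ P 0 (3 + v) ⊕ P (1 + v) (3 + v)
    above-diagonal = trans (Σℙ<-cong (suc v) entry) (Σℙ<-pascal-column firstRow (suc v) (2 + v))
      where
      entry : ∀ l → l < suc v → f l ≡ P l (2 + v)
      entry l l<1+v = trans
        (cong fromBool (symm (2 + v) (suc l) (s≤s z≤n) j≤n (s≤s z≤n) (≤-trans l<1+v (≤-trans (n≤1+n _) j≤n))))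
        (steinhaus-pascal l (2 + v) (s≤s l<1+v) j≤n)
    on-diagonal : f (suc v + 0) ≡ 0ℙ
    on-diagonal = cong fromBool
      (trans (cong (λ x → a (2 + v) (suc x)) (+-identityʳ (suc v))) (diag (2 + v) (s≤s z≤n) j≤n))
    right-of-diagonal : Σℙ< r (λ t → f (suc v + suc t)) ≡ P v (2 + v) ⊕ P v n
    right-of-diagonal = begin
      Σℙ< r (λ t → f (suc v + suc t))
        ≡⟨ Σℙ<-cong r entry ⟩
      Σℙ< r (λ t → P (suc v) (suc (t + (2 + v))))
        ≡⟨ Σℙ<-pascal-row firstRow r v (2 + v) ⟩
      P v (2 + v) ⊕ P v (r + (2 + v))
        ≡⟨ cong (λ x → P v (2 + v) ⊕ P v x) (m∸n+n≡m j≤n) ⟩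
      P v (2 + v) ⊕ P v n
        ∎
      where
      entry : ∀ t → t < r → f (suc v + suc t) ≡ P (suc v) (suc (t + (2 + v)))
      entry t t<r = trans (cong (λ x → fromBool (a (2 + v) (suc x))) column≡)
        (steinhaus-pascal (suc v) (suc (t + (2 + v))) (s≤s (m≤n+m (2 + v) t)) column≤n)
        where
        column≡ : suc v + suc t ≡ t + (2 + v)
        column≡ = trans (+-comm (suc v) (suc t)) (sym (+-suc t (suc v)))
        column≤n : suc (t + (2 + v)) ≤ n
        column≤n = m≤o∸n⇒m+n≤o (suc t) j≤n t<r

  parity-Σ<-binomial-deg : ∀ m → 2 + m + m ≤ n →
    parity (Σ< (suc m) (λ k → (m C k) * deg n a (suc m + k + 1))) ≡ fromBool (a (suc m) (n ∸ m))
  parity-Σ<-binomial-deg m 2i≤n = begin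
    parity (Σ< (suc m) (λ k → (m C k) * deg n a (suc m + k + 1)))
      ≡⟨ parity-Σ<-binomial m (λ k → deg n a (suc m + k + 1)) ⟩
    Δ m (λ k → parity (deg n a (suc m + k + 1)))
      ≡⟨ Δ-cong m (λ k k≤m → trans (cong (λ j → parity (deg n a j)) (+-comm (suc m + k) 1))
                                   (parity-deg (m + k) (≤-trans (+-monoʳ-≤ (2 + m) k≤m) 2i≤n))) ⟩
    Δ m (λ k → (P 0 (3 + m + k) ⊕ P (1 + m + k) (3 + m + k)) ⊕ (P (m + k) (2 + m + k) ⊕ P (m + k) n))
      ≡⟨ trans (Δ-⊕ m _ _) (cong₂ _⊕_ (Δ-⊕ m _ _) (Δ-⊕ m _ _)) ⟩
    (Δ m (λ k → P 0 (3 + m + k)) ⊕ Δ m (λ k → P (1 + m + k) (3 + m + k)))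
      ⊕ (Δ m (λ k → P (m + k) (2 + m + k)) ⊕ Δ m (λ k → P (m + k) n))
      ≡⟨ cong₂ _⊕_ (cong₂ _⊕_ (Δ-pascal-row firstRow m 0 (3 + m)) (Δ-pascal-diagonal firstRow m (1 + m) (3 + m)))
                   (cong₂ _⊕_ (Δ-pascal-diagonal firstRow m m (2 + m)) antidiagonal) ⟩
    (x ⊕ (y ⊕ x)) ⊕ (y ⊕ P m (n ∸ m))
      ≡⟨ cong (_⊕ (y ⊕ P m (n ∸ m))) (p⊕[q⊕p]≡q x y) ⟩
    y ⊕ (y ⊕ P m (n ∸ m))
      ≡⟨ p⊕[p⊕q]≡q y _ ⟩
    P m (n ∸ m)
      ≡⟨ steinhaus-pascal m (n ∸ m) (m+n≤o⇒m≤o∸n (2 + m) 2i≤n) (m∸n≤m n m) ⟨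
    fromBool (a (suc m) (n ∸ m))
      ∎
    where
    x = P m (3 + m + m)
    y = P m (2 + m + m)
    m≤n : m ≤ n
    m≤n = ≤-trans (m≤n+m m (2 + m)) 2i≤n
    antidiagonal : Δ m (λ k → P (m + k) n) ≡ P m (n ∸ m)
    antidiagonal = trans (Δ-cong m (λ k _ → cong (P (m + k)) (sym (m∸n+n≡m m≤n))))
                         (Δ-pascal-column firstRow m m (n ∸ m))

  deg-antitranspose : ∀ j → 1 ≤ j → j ≤ n → deg n (antitranspose n a) j ≡ deg n a (suc n ∸ j)
  deg-antitranspose j 1≤j j≤n = sym (begin
    Σ< n (λ l → b2n (a c (suc l)))            ≡⟨ Σ<-reverse n (λ l → b2n (a c (suc l))) ⟩
    Σ< n (λ l → b2n (a c (suc (n ∸ suc l))))  ≡⟨ Σ<-cong n (λ l l<n → cong b2n (entry l l<n)) ⟩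
    Σ< n (λ l → b2n (a (n ∸ l) c))            ∎)
    where
    c = suc n ∸ j
    entry : ∀ l → l < n → a c (suc (n ∸ suc l)) ≡ a (n ∸ l) c
    entry l l<n = trans (cong (a c) (sym (+-∸-assoc 1 l<n)))
      (symm c (n ∸ l) (1≤1+n∸i j≤n) (1+n∸i≤n 1≤j) (m<n⇒0<n∸m l<n) (m∸n≤m n l))

  isSteinhaus-antitranspose : IsSteinhaus n (antitranspose n a)
  isSteinhaus-antitranspose = record
    { diag = λ i 1≤i i≤n → diag (suc n ∸ i) (1≤1+n∸i i≤n) (1+n∸i≤n 1≤i)
    ; step = step-antitranspose
    ; symm = λ i j 1≤i i≤n 1≤j j≤n →
        symm (suc n ∸ j) (suc n ∸ i) (1≤1+n∸i j≤n) (1+n∸i≤n 1≤j) (1≤1+n∸i i≤n) (1+n∸i≤n 1≤i)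
    }
    where
    -- The Pascal rule at (I+1, J+1), read backwards: a I J = a (I+1) (J+1) + a I (J+1).
    step-antitranspose : ∀ i j → 2 ≤ i → i < j → j ≤ n →
      antitranspose n a i j ≡ (antitranspose n a (i ∸ 1) (j ∸ 1) xor antitranspose n a (i ∸ 1) j)
    step-antitranspose (suc (suc i)) (suc j) (s≤s (s≤s z≤n)) (s≤s 1+i<j) j<n = begin
      a I J                             ≡⟨ xor-cancelʳ (a I J) (a I (suc J)) ⟨
      (a I J xor a I (suc J)) xor a I (suc J)
        ≡⟨ cong (_xor a I (suc J)) (step-suc I J (m<n⇒0<n∸m j<n) (∸-monoʳ-< 1+i<j (<⇒≤ j<n)) 1+J≤n) ⟨
      a (suc I) (suc J) xor a I (suc J) ≡⟨ cong₂ (λ x y → a x y xor a I y) (sym 1+I≡) (sym 1+J≡) ⟩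
      a (suc n ∸ j) (n ∸ i) xor a I (n ∸ i) ∎
      where
      I = n ∸ j
      J = n ∸ suc i
      1+I≡ : suc n ∸ j ≡ suc I
      1+I≡ = +-∸-assoc 1 (<⇒≤ j<n)
      1+J≡ : n ∸ i ≡ suc J
      1+J≡ = +-∸-assoc 1 (<⇒≤ (≤-trans 1+i<j (<⇒≤ j<n)))
      1+J≤n : suc J ≤ n
      1+J≤n = ≤-trans (≤-reflexive (sym 1+J≡)) (m∸n≤m n i)

  Σ<-binomial-deg-antitranspose : ∀ m → 2 + m + m ≤ n →
    Σ< (suc m) (λ k → (m C k) * deg n (antitranspose n a) (suc m + k + 1))
      ≡ Σ< (suc m) (λ k → (m C k) * deg n a (n ∸ suc m ∸ k))
  Σ<-binomial-deg-antitranspose m 2i≤n = Σ<-cong (suc m) (λ k k<1+m → cong ((m C k) *_) (begin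
    deg n (antitranspose n a) (suc m + k + 1)
      ≡⟨ deg-antitranspose (suc m + k + 1) (m≤n+m 1 (suc m + k)) (vertex≤n k (s≤s⁻¹ k<1+m)) ⟩
    deg n a (n ∸ (m + k + 1))
      ≡⟨ cong (λ x → deg n a (n ∸ x)) (+-comm (m + k) 1) ⟩
    deg n a (n ∸ (suc m + k))
      ≡⟨ cong (deg n a) (∸-+-assoc n (suc m) k) ⟨
    deg n a (n ∸ suc m ∸ k)
      ∎))
    where
    vertex≤n : ∀ k → k ≤ m → suc m + k + 1 ≤ n
    vertex≤n k k≤m = ≤-trans (≤-reflexive (+-comm (suc m + k) 1)) (≤-trans (+-monoʳ-≤ (2 + m) k≤m) 2i≤n)

theorem2 : (n : ℕ) (a : Matrix) → 2 ≤ n → IsSteinhaus n a →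
  (i : ℕ) → 1 ≤ i → i ≤ n / 2 →
  (b2n (a i (n ∸ i + 1)) % 2
      ≡ Σ< i (λ k → ((i ∸ 1) C k) * deg n a (i + k + 1)) % 2)
  × (Σ< i (λ k → ((i ∸ 1) C k) * deg n a (i + k + 1)) % 2
      ≡ Σ< i (λ k → ((i ∸ 1) C k) * deg n a (n ∸ i ∸ k)) % 2)
theorem2 n a _ steinhaus (suc m) _ i≤n/2 =
  parity≡⇒%2≡ (b2n (a (suc m) (n ∸ suc m + 1))) L first , parity≡⇒%2≡ L R second
  where
  L R : ℕ
  L = Σ< (suc m) (λ k → (m C k) * deg n a (suc m + k + 1))
  R = Σ< (suc m) (λ k → (m C k) * deg n a (n ∸ suc m ∸ k))
  2i≤n : 2 + m + m ≤ n
  2i≤n = ≤-trans (≤-reflexive (cong suc (sym (+-suc m m)))) (i≤n/2⇒i+i≤n (suc m) n i≤n/2)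
  i≤n : suc m ≤ n
  i≤n = <⇒≤ (≤-trans (m≤m+n (2 + m) m) 2i≤n)
  first : fromBool (a (suc m) (n ∸ suc m + 1)) ≡ parity L
  first = begin
    fromBool (a (suc m) (n ∸ suc m + 1))
      ≡⟨ cong (λ j → fromBool (a (suc m) j)) (trans (sym (+-∸-comm 1 i≤n)) (cong (_∸ suc m) (+-comm n 1))) ⟩
    fromBool (a (suc m) (n ∸ m))
      ≡⟨ parity-Σ<-binomial-deg steinhaus m 2i≤n ⟨
    parity L
      ∎
  second : parity L ≡ parity R
  second = begin
    parity L
      ≡⟨ parity-Σ<-binomial-deg steinhaus m 2i≤n ⟩
    fromBool (a (suc m) (n ∸ m))
      ≡⟨ cong (λ x → fromBool (a x (n ∸ m))) (m∸[m∸n]≡n (m≤n⇒m≤1+n i≤n)) ⟨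
    fromBool (antitranspose n a (suc m) (n ∸ m))
      ≡⟨ parity-Σ<-binomial-deg (isSteinhaus-antitranspose steinhaus) m 2i≤n ⟨
    parity (Σ< (suc m) (λ k → (m C k) * deg n (antitranspose n a) (suc m + k + 1)))
      ≡⟨ cong parity (Σ<-binomial-deg-antitranspose steinhaus m 2i≤n) ⟩
    parity R
      ∎
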